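{- Consider a run of the timed gluttonous algorithm on an instance $\mathcal{I}=(\mathcal{M},\mathcal{D})$, and a stage $i$. Let $\mathcal{C}_i$ be the clustering at the beginning of stage $i$ and $\mathcal{M}_i=\mathcal{M}/\mathcal{C}_i$. Define a graph $\mathcal{G}_i$ with vertex set $\mathcal{C}_i$, in which two supernodes $C_1,C_2\in\mathcal{C}_i$ that are both active during stage $i$ are adjacent if there is a path between them of length at most $2^{i+1}$ in $\mathcal{M}_i$ (i.e., in $G_{\mathcal{C}_i}$) that contains no other active supernode as an internal node. If the connected components of $\mathcal{G}_i$ are $H_1,\dots,H_q$, then the clustering at the beginning of stage $i+1$ has exactly $q$ supernodes, one for each $H_j$, namely the union of the supernodes in $H_j$.
   Context: A Steiner forest instance $(\mathcal{M},\mathcal{D})$: a finite metric space $\mathcal{M}=(V,d)$ in which all distances are $0$ or at least $1$, and a set $\mathcal{D}$ of pairwise disjoint pairs $\{u,\bar u\}\subseteq V$ with $d(u,\bar u)>0$ (terminals; $\bar u$ is the mate of $u$; terminals carry distinct indices). A clustering is a partition of the terminals into supernodes. For a clustering $\mathcal{C}$, $G_{\mathcal{C}}$ is the complete graph on $V$ with edge $\{x,y\}$ of length $0$ if $x,y$ are terminals in a common supernode and $d(x,y)$ otherwise; $\mathcal{M}/\mathcal{C}$ denotes the shortest-path metric $d_{\mathcal{M}/\mathcal{C}}$ of $G_{\mathcal{C}}$, and $d_{\mathcal{M}/\mathcal{C}}(S_1,S_2)=\min_{u\in S_1,v\in S_2}d_{\mathcal{M}/\mathcal{C}}(u,v)$.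 Timed gluttonous algorithm: let $\mathrm{level}(s)=\lceil\log_2 d(s,\bar s)\rceil$; the leader of a supernode $S$ is the terminal of $S$ maximizing $d(s,\bar s)$ (ties: smallest index). Start with singletons and $E'=\emptyset$. For stages $i=0,1,2,\dots$: a supernode is active during stage $i$ if its leader has level $\ge i$; while there exist two distinct active supernodes $S',S''$ of the current clustering $\mathcal{C}$ with $d_{\mathcal{M}/\mathcal{C}}(S',S'')\le 2^{i+1}$, pick any such pair (arbitrary choice), add to $E'$ the inter-supernode edges of a path in $G_{\mathcal{C}}$ between them of length at most $2^{i+1}$, and replace $S',S''$ by $S'\cup S''$. Stop once no terminal has level $\ge i$; output a maximal acyclic subgraph of $E'$.
   Formalization: The distances $d$ of the metric space $\mathcal{M}$ take rational values. -}

module Defs where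

open import Data.Nat as ℕ using (ℕ; zero; suc; _^_)
open import Data.Integer using (+_)
open import Data.Rational using (ℚ; 0ℚ; 1ℚ; _/_; _+_; _≤_; _<_)
open import Data.Fin using (Fin; toℕ; _≟_)
open import Data.Maybe using (Maybe; just; nothing; is-just)
open import Data.Bool using (Bool; true; false; if_then_else_; _∧_)
open import Data.List using (List; []; _∷_; _++_)
open import Data.List.Membership.Propositional using (_∈_)
open import Data.List.Relation.Unary.Unique.Propositional using (Unique)
open import Data.Product using (Σ; ∃; ∃-syntax; _×_; _,_)
open import Data.Sum using (_⊎_)
open import Relation.Nullary using (¬_; does)
open import Relation.Binary.PropositionalEquality using (_≡_; _≢_)
open import Relation.Binary.Construct.Closure.ReflexiveTransitive using (Star)

-- Steiner forest instance on the vertex set V = Fin n.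
-- The demand set D is encoded by the partial mate function:
-- mate u ≡ just ū  iff  {u, ū} ∈ D.

record Instance (n : ℕ) : Set where
  field
    d        : Fin n → Fin n → ℚ
    d-refl   : ∀ x → d x x ≡ 0ℚ
    d-ident  : ∀ x y → d x y ≡ 0ℚ → x ≡ y
    d-sym    : ∀ x y → d x y ≡ d y x
    d-tri    : ∀ x y z → d x z ≤ d x y + d y z
    d-gap    : ∀ x y → d x y ≡ 0ℚ ⊎ 1ℚ ≤ d x y
    mate     : Fin n → Maybe (Fin n)
    mate-sym : ∀ u v → mate u ≡ just v → mate v ≡ just u
    mate-pos : ∀ u v → mate u ≡ just v → 0ℚ < d u v

pow2 : ℕ → ℚ
pow2 k = (+ (2 ^ k)) / 1

module _ {n : ℕ} (I : Instance n) where
  open Instance I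

  IsTerm : Fin n → Set
  IsTerm s = ∃[ m ] (mate s ≡ just m)

  -- d(s, s̄) for a terminal s (0 for non-terminals, never used there)
  md : Fin n → ℚ
  md s with mate s
  ... | just m  = d s m
  ... | nothing = 0ℚ

  -- level k = ⌈log₂ x⌉, i.e. the least k with x ≤ 2^k (x ≥ 1)
  IsLevel : ℚ → ℕ → Set
  IsLevel x k = x ≤ pow2 k × (∀ j → x ≤ pow2 j → k ℕ.≤ j)

  LevelGe : Fin n → ℕ → Set
  LevelGe s i = ∃[ k ] (IsLevel (md s) k × i ℕ.≤ k)

  -- A clustering: a labelling of vertices; the supernodes are the
  -- classes of terminals with equal label.
  Clustering : Set
  Clustering = Fin n → Fin n

  InSN : Clustering → Fin n → Fin n → Set
  InSN C a x = IsTerm x × C x ≡ C a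

  IsLeader : Clustering → Fin n → Fin n → Set
  IsLeader C a l =
    InSN C a l ×
    (∀ t → InSN C a t → md t < md l ⊎ (md t ≡ md l × toℕ l ℕ.≤ toℕ t))

  Active : Clustering → ℕ → Fin n → Set
  Active C i a = IsTerm a × ∃[ l ] (IsLeader C a l × LevelGe l i)

  sameSN : Clustering → Fin n → Fin n → Bool
  sameSN C x y = is-just (mate x) ∧ is-just (mate y) ∧ does (C x ≟ C y)

  elen : Clustering → Fin n → Fin n → ℚ
  elen C x y = if sameSN C x y then 0ℚ else d x y

  -- length of the walk x, v₁, …, v_k in G_C
  wlen : Clustering → Fin n → List (Fin n) → ℚ
  wlen C x []       = 0ℚ
  wlen C x (y ∷ ys) = elen C x y + wlen C y ys

  wend : Fin n → List (Fin n) → Fin n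
  wend x []       = x
  wend x (y ∷ ys) = wend y ys

  -- d_{M/C}(S_a, S_b) ≤ L  (shortest-path metric of G_C)
  DistLe : Clustering → ℚ → Fin n → Fin n → Set
  DistLe C L a b =
    ∃[ u ] ∃[ ps ] (InSN C a u × InSN C b (wend u ps) × wlen C u ps ≤ L)

  Mergeable : ℕ → Clustering → Fin n → Fin n → Set
  Mergeable i C a b =
    Active C i a × Active C i b × C a ≢ C b × DistLe C (pow2 (suc i)) a b

  merge : Clustering → Fin n → Fin n → Clustering
  merge C a b x = if does (C x ≟ C b) then C a else C x

  data StageStep (i : ℕ) : Clustering → Clustering → Set where
    step : ∀ C a b → Mergeable i C a b → StageStep i C (merge C a b)

  StageDone : ℕ → Clustering → Set
  StageDone i C = ¬ (∃[ a ] ∃[ b ] Mergeable i C a b)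

  StageRun : ℕ → Clustering → Clustering → Set
  StageRun i C C' = Star (StageStep i) C C' × StageDone i C'

  -- a run: Cs i is the clustering at the beginning of stage i
  -- (after the algorithm stops, further stages are trivially the identity,
  -- since no supernode is active)
  record Run : Set where
    field
      Cs      : ℕ → Clustering
      initial : ∀ x y → IsTerm x → IsTerm y → Cs zero x ≡ Cs zero y → x ≡ y
      stages  : ∀ i → StageRun i (Cs i) (Cs (suc i))

  -- adjacency in the graph 𝒢_i (on supernodes of C, given by
  -- representative terminals a, b): both active, distinct, and a path
  -- u, ms…, v in G_C from S_a to S_b (no repeated vertex) of length at most
  -- 2^{i+1} whose internal nodes lie in no active supernode other than
  -- S_a, S_b.
  Adj : ℕ → Clustering → Fin n → Fin n → Set
  Adj i C a b =
    Active C i a × Active C i b × C a ≢ C b ×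
    ∃[ u ] ∃[ ms ] ∃[ v ]
      ( InSN C a u × InSN C b v
      × Unique (u ∷ ms ++ v ∷ [])
      × wlen C u (ms ++ v ∷ []) ≤ pow2 (suc i)
      × (∀ w → w ∈ ms → ¬ (∃[ c ] (Active C i c × InSN C c w × C c ≢ C a × C c ≢ C b))))

  -- edges of 𝒢_i, plus identification of representatives of the same supernode
  AdjOrSame : ℕ → Clustering → Fin n → Fin n → Set
  AdjOrSame i C a b = Adj i C a b ⊎ (IsTerm a × IsTerm b × C a ≡ C b)

  Connected : ℕ → Clustering → Fin n → Fin n → Set
  Connected i C = Star (AdjOrSame i C)

module Submission where

-- Every supernode of every clustering has a leader (a maximum for a total order on vertices), so
-- a supernode is active iff one of its members has level ≥ i; activity is thus decidable and
-- survives coarsening.  During stage i every merge joins two active supernodes of the current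
-- clustering C by a walk of length at most 2^{i+1} in G_C.  Invariantly, C coarsens D = C_i and
-- any two terminals that C puts together are connected in 𝒢_i, hence were already together in D
-- or are both active.  So an edge with an inactive endpoint is no shorter in G_D than in G_C:
-- cutting a merge walk at its active vertices and loop-erasing each piece in G_D yields edges of
-- 𝒢_i (or pieces inside one supernode of C).  Conversely, when the stage ends no two active
-- supernodes are within 2^{i+1}, and lengths only shrink under coarsening, so the two ends of
-- every edge of 𝒢_i lie in one supernode of C_{i+1}.

open import Defs
open import Data.Nat as ℕ using (ℕ; zero; suc; _^_; z≤n)
import Data.Nat.Properties as ℕ
open import Data.Integer as ℤ using (+≤+)
import Data.Integer.Properties as ℤ
open import Data.Nat.Coprimality using (1-coprimeTo) renaming (sym to coprime-sym)
open import Data.Rational using (mkℚ; 0ℚ; _+_; _≤_; _<_; *≤*)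
open import Data.Rational.Properties
  using (≤-refl; ≤-reflexive; ≤-trans; <⇒≤; <-≤-trans; ≤-<-trans; <-irrefl; <-cmp; _≤?_;
         +-mono-≤; +-monoˡ-≤; +-monoʳ-≤; +-comm; +-assoc; +-identityˡ; +-identityʳ;
         normalize-coprime)
open import Data.Fin using (Fin; toℕ; _≟_)
open import Data.Fin.Properties using (toℕ-injective)
open import Data.Maybe using (just; nothing; is-just)
open import Data.Bool using (true; false; if_then_else_)
open import Data.List using (List; []; _∷_; _++_; _∷ʳ_; filter; allFin; InitLast; initLast; _∷ʳ′_)
open import Data.List.Properties using (∷ʳ-++)
open import Data.List.Relation.Unary.All as All using (All; []; _∷_)
open import Data.List.Relation.Unary.All.Properties
  using (¬Any⇒All¬; all-filter; anti-mono; ++⁺; ∷ʳ⁺)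
open import Data.List.Relation.Unary.Any using (here; there)
open import Data.List.Relation.Unary.AllPairs using ([]; _∷_)
open import Data.List.Relation.Unary.Linked using (Linked; [-]; _∷_)
open import Data.List.Relation.Unary.Unique.Propositional using (Unique)
open import Data.List.Membership.Propositional using (_∈_; _∉_)
open import Data.List.Membership.Propositional.Properties
  using (∈-∃++; ∈-++⁺ˡ; ∈-++⁺ʳ; ∈-++⁻; ∈-filter⁺; ∈-allFin)
open import Data.List.Relation.Binary.Subset.Propositional using (_⊆_)
open import Data.List.Relation.Binary.Subset.Propositional.Properties using (∷⁺ʳ)
open import Data.Product using (∃-syntax; _×_; _,_; proj₁; proj₂; map₁)
open import Data.Sum using (_⊎_; inj₁; inj₂; [_,_]′) renaming (map to ⊎-map)
open import Data.Empty using (⊥-elim)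
open import Function using (id; _∘_)
open import Level using (0ℓ)
open import Relation.Nullary using (¬_; Dec; yes; no; does; contradiction)
open import Relation.Nullary.Decidable using (map′; _×-dec_; toSum; decidable-stable)
open import Relation.Binary
  using (TotalOrder; Transitive; Antisymmetric; Total; _⇒_; tri<; tri≈; tri>)
open import Relation.Binary.PropositionalEquality
open import Relation.Binary.Construct.Closure.ReflexiveTransitive using (Star; ε; _◅_; _◅◅_)

n≤2^n : ∀ m → m ℕ.≤ 2 ^ m
n≤2^n zero = z≤n
n≤2^n (suc m) = ℕ.+-mono-≤ (ℕ.^-monoʳ-≤ 2 {0} {m} z≤n) (ℕ.≤-trans (n≤2^n m) (ℕ.m≤m+n _ 0))

i≤+∣i∣ : ∀ i → i ℤ.≤ ℤ.+ ℤ.∣ i ∣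
i≤+∣i∣ (ℤ.+ m) = ℤ.≤-refl
i≤+∣i∣ ℤ.-[1+ m ] = ℤ.-≤+

q≤p+q : ∀ {p q} → 0ℚ ≤ p → q ≤ p + q
q≤p+q {p} {q} 0≤p = subst (_≤ p + q) (+-identityˡ q) (+-monoˡ-≤ q 0≤p)

does-≟-sym : ∀ {n} (p q : Fin n) → does (p ≟ q) ≡ does (q ≟ p)
does-≟-sym p q with p ≟ q | q ≟ p
... | yes _ | yes _ = refl
... | no _ | no _ = refl
... | yes p≡q | no q≢p = contradiction (sym p≡q) q≢p
... | no p≢q | yes q≡p = contradiction (sym q≡p) p≢q

unique-suffix : ∀ {A : Set} {ys : List A} xs → Unique (xs ++ ys) → Unique ys
unique-suffix [] u = u
unique-suffix (_ ∷ xs) (_ ∷ u) = unique-suffix xs u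

⊆-∷ʳ⁻ : ∀ {A : Set} {xs ys : List A} {y} → y ∉ xs → xs ⊆ ys ∷ʳ y → xs ⊆ ys
⊆-∷ʳ⁻ {ys = ys} y∉xs xs⊆ w∈xs with ∈-++⁻ ys (xs⊆ w∈xs)
... | inj₁ w∈ys = w∈ys
... | inj₂ (here refl) = contradiction w∈xs y∉xs

∷ʳ-unique⇒∉ : ∀ {A : Set} xs {y : A} → Unique (xs ∷ʳ y) → y ∉ xs
∷ʳ-unique⇒∉ (x ∷ xs) (x≢ ∷ _) (here refl) = All.lookup x≢ (∈-++⁺ʳ xs (here refl)) refl
∷ʳ-unique⇒∉ (x ∷ xs) (_ ∷ u) (there y∈xs) = ∷ʳ-unique⇒∉ xs u y∈xs

module _ {n : ℕ} (I : Instance n) where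
  open Instance I
  open import Data.List.Membership.DecPropositional (_≟_ {n}) using (_∈?_)

  -- Levels

  pow2≡mkℚ : ∀ k → pow2 k ≡ mkℚ (ℤ.+ 2 ^ k) 0 (coprime-sym (1-coprimeTo (2 ^ k)))
  pow2≡mkℚ k = normalize-coprime _

  pow2-mono : ∀ {j k} → j ℕ.≤ k → pow2 j ≤ pow2 k
  pow2-mono {j} {k} j≤k rewrite pow2≡mkℚ j | pow2≡mkℚ k =
    *≤* (subst₂ ℤ._≤_ (sym (ℤ.*-identityʳ _)) (sym (ℤ.*-identityʳ _)) (+≤+ (ℕ.^-monoʳ-≤ 2 j≤k)))

  pow2-bound : ∀ q → ∃[ B ] (q ≤ pow2 B)
  pow2-bound q@(mkℚ num d-1 _) = B , subst (q ≤_) (sym (pow2≡mkℚ B)) (*≤* num≤)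
    where
    B : ℕ
    B = ℤ.∣ num ∣
    num≤ : num ℤ.* ℤ.+ 1 ℤ.≤ ℤ.+ 2 ^ B ℤ.* ℤ.+ suc d-1
    num≤ = subst₂ ℤ._≤_ (sym (ℤ.*-identityʳ num)) (ℤ.pos-* (2 ^ B) (suc d-1))
      (ℤ.≤-trans (i≤+∣i∣ num) (+≤+ (ℕ.≤-trans (n≤2^n B) (ℕ.m≤m*n (2 ^ B) (suc d-1)))))

  least-level : ∀ q B → q ≤ pow2 B → ∃[ k ] IsLevel I q k
  least-level q zero q≤ = 0 , q≤ , λ _ _ → z≤n
  least-level q (suc B) q≤ with q ≤? pow2 B
  ... | yes q≤′ = least-level q B q≤′
  ... | no q≰ = suc B , q≤ , λ j q≤2^j → ℕ.≰⇒> (λ j≤B → q≰ (≤-trans q≤2^j (pow2-mono j≤B)))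

  level : ∀ q → ∃[ k ] IsLevel I q k
  level q = let (B , q≤) = pow2-bound q in least-level q B q≤

  isLevel-mono : ∀ {p q j k} → p ≤ q → IsLevel I p j → IsLevel I q k → j ℕ.≤ k
  isLevel-mono p≤q (_ , least) (q≤ , _) = least _ (≤-trans p≤q q≤)

  levelGe-mono : ∀ {s t i} → md I s ≤ md I t → LevelGe I s i → LevelGe I t i
  levelGe-mono {t = t} s≤t (j , lvs , i≤j) =
    let (k , lvt) = level (md I t) in k , lvt , ℕ.≤-trans i≤j (isLevel-mono s≤t lvs lvt)

  levelGe? : ∀ s i → Dec (LevelGe I s i)
  levelGe? s i =
    let (k , lv) = level (md I s) in
    map′ (λ i≤k → k , lv , i≤k) (λ (j , lvj , i≤j) → ℕ.≤-trans i≤j (isLevel-mono ≤-refl lvj lv))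
         (i ℕ.≤? k)

  -- Leaders and active supernodes

  -- IsLeader C a l unfolds to: l ∈ S_a and t ⊑ l for every t ∈ S_a.
  infix 4 _⊑_
  _⊑_ : Fin n → Fin n → Set
  t ⊑ l = md I t < md I l ⊎ (md I t ≡ md I l × toℕ l ℕ.≤ toℕ t)

  ⊑⇒md≤ : ∀ {t l} → t ⊑ l → md I t ≤ md I l
  ⊑⇒md≤ (inj₁ t<l) = <⇒≤ t<l
  ⊑⇒md≤ (inj₂ (t≡l , _)) = ≤-reflexive t≡l

  ⊑-reflexive : _≡_ ⇒ _⊑_
  ⊑-reflexive refl = inj₂ (refl , ℕ.≤-refl)

  ⊑-trans : Transitive _⊑_
  ⊑-trans (inj₁ t<m) m⊑l = inj₁ (<-≤-trans t<m (⊑⇒md≤ m⊑l))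
  ⊑-trans (inj₂ (t≡m , _)) (inj₁ m<l) = inj₁ (≤-<-trans (≤-reflexive t≡m) m<l)
  ⊑-trans (inj₂ (t≡m , m≤t)) (inj₂ (m≡l , l≤m)) = inj₂ (trans t≡m m≡l , ℕ.≤-trans l≤m m≤t)

  ⊑-antisym : Antisymmetric _≡_ _⊑_
  ⊑-antisym (inj₁ t<l) l⊑t = contradiction (<-≤-trans t<l (⊑⇒md≤ l⊑t)) (<-irrefl refl)
  ⊑-antisym (inj₂ (t≡l , _)) (inj₁ l<t) =
    contradiction (<-≤-trans l<t (≤-reflexive t≡l)) (<-irrefl refl)
  ⊑-antisym (inj₂ (_ , l≤t)) (inj₂ (_ , t≤l)) = toℕ-injective (ℕ.≤-antisym t≤l l≤t)

  ⊑-total : Total _⊑_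
  ⊑-total t l with <-cmp (md I t) (md I l) | ℕ.≤-total (toℕ l) (toℕ t)
  ... | tri< t<l _ _ | _ = inj₁ (inj₁ t<l)
  ... | tri> _ _ l<t | _ = inj₂ (inj₁ l<t)
  ... | tri≈ _ t≡l _ | inj₁ l≤t = inj₁ (inj₂ (t≡l , l≤t))
  ... | tri≈ _ t≡l _ | inj₂ t≤l = inj₂ (inj₂ (sym t≡l , t≤l))

  ⊑-totalOrder : TotalOrder 0ℓ 0ℓ 0ℓ
  ⊑-totalOrder = record
    { isTotalOrder = record
      { isPartialOrder = record
        { isPreorder = record
          { isEquivalence = isEquivalence ; reflexive = ⊑-reflexive ; trans = ⊑-trans }
        ; antisym = ⊑-antisym }
      ; total = ⊑-total } }

  open import Data.List.Extrema ⊑-totalOrder using (max; xs≤max; argmax-all)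

  isTerm? : ∀ s → Dec (IsTerm I s)
  isTerm? s with mate s
  ... | just s̄ = yes (s̄ , refl)
  ... | nothing = no λ ()

  inSN? : ∀ C a t → Dec (InSN I C a t)
  inSN? C a t = isTerm? t ×-dec (C t ≟ C a)

  leader : ∀ C {a} → IsTerm I a → ∃[ l ] IsLeader I C a l
  leader C {a} ta = l , argmax-all id (ta , refl) (all-filter (inSN? C a) (allFin n)) , beaten
    where
    supernode : List (Fin n)
    supernode = filter (inSN? C a) (allFin n)
    l : Fin n
    l = max a supernode
    beaten : ∀ t → InSN I C a t → t ⊑ l
    beaten t t∈a = All.lookup (xs≤max a supernode) (∈-filter⁺ (inSN? C a) (∈-allFin t) t∈a)

  member⇒active : ∀ {C i a t} → IsTerm I a → InSN I C a t → LevelGe I t i → Active I C i a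
  member⇒active {C} ta t∈a lvt =
    let (l , l∈a , beats) = leader C ta in
    ta , l , (l∈a , beats) , levelGe-mono (⊑⇒md≤ (beats _ t∈a)) lvt

  active-mono : ∀ {E G i a b} → IsTerm I b → (∀ {t} → InSN I E a t → InSN I G b t) →
    Active I E i a → Active I G i b
  active-mono tb E⊆G (_ , _ , (l∈a , _) , lvl) = member⇒active tb (E⊆G l∈a) lvl

  active-cong : ∀ {C i c w} → IsTerm I w → C c ≡ C w → Active I C i c → Active I C i w
  active-cong tw c≡w = active-mono tw λ (tt , t∈c) → tt , trans t∈c c≡w

  Coarsens : Clustering I → Clustering I → Set
  Coarsens E G = ∀ {x y} → E x ≡ E y → G x ≡ G y

  active-coarsen : ∀ {E G i a} → Coarsens E G → Active I E i a → Active I G i a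
  active-coarsen E⇒G aa = active-mono (proj₁ aa) (λ (tt , t∈a) → tt , E⇒G t∈a) aa

  active? : ∀ C i a → Dec (Active I C i a)
  active? C i a with isTerm? a
  ... | no ¬ta = no (¬ta ∘ proj₁)
  ... | yes ta =
    let (l , ld) = leader C ta in
    map′ (λ lvl → ta , l , ld , lvl)
         (λ (_ , l′ , (l′∈a , _) , lvl′) → levelGe-mono (⊑⇒md≤ (proj₂ ld l′ l′∈a)) lvl′)
         (levelGe? l i)

  -- Walks in G_C

  d-nonneg : ∀ x y → 0ℚ ≤ d x y
  d-nonneg x y with d-gap x y
  ... | inj₁ d≡0 = ≤-reflexive (sym d≡0)
  ... | inj₂ 1≤d = ≤-trans (*≤* (+≤+ z≤n)) 1≤d

  elen-nonneg : ∀ C x y → 0ℚ ≤ elen I C x y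
  elen-nonneg C x y with sameSN I C x y
  ... | true = ≤-refl
  ... | false = d-nonneg x y

  sameSN-sym : ∀ C x y → sameSN I C x y ≡ sameSN I C y x
  sameSN-sym C x y with is-just (mate x) | is-just (mate y)
  ... | true | true = does-≟-sym (C x) (C y)
  ... | true | false = refl
  ... | false | true = refl
  ... | false | false = refl

  elen-sym : ∀ C x y → elen I C x y ≡ elen I C y x
  elen-sym C x y rewrite sameSN-sym C x y | d-sym x y = refl

  CoarsensAt : Clustering I → Clustering I → Fin n → Fin n → Set
  CoarsensAt E G x y = IsTerm I x → IsTerm I y → E x ≡ E y → G x ≡ G y

  elen-antitone : ∀ E G {x y} → CoarsensAt E G x y → elen I G x y ≤ elen I E x y
  elen-antitone E G {x} {y} E⇒G with mate x | mate y
  ... | nothing | _ = ≤-refl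
  ... | just _ | nothing = ≤-refl
  ... | just x̄ | just ȳ with E x ≟ E y | G x ≟ G y
  ... | yes _ | yes _ = ≤-refl
  ... | yes E≡ | no G≢ = contradiction (E⇒G (x̄ , refl) (ȳ , refl) E≡) G≢
  ... | no _ | yes _ = d-nonneg x y
  ... | no _ | no _ = ≤-refl

  wlen-antitone : ∀ {E G x} ps → Linked (CoarsensAt E G) (x ∷ ps) →
    wlen I G x ps ≤ wlen I E x ps
  wlen-antitone [] _ = ≤-refl
  wlen-antitone {E} {G} (y ∷ ps) (xy ∷ rest) =
    +-mono-≤ (elen-antitone E G xy) (wlen-antitone ps rest)

  wlen-coarsen : ∀ {E G} → Coarsens E G → ∀ x ps → wlen I G x ps ≤ wlen I E x ps
  wlen-coarsen E⇒G x [] = ≤-refl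
  wlen-coarsen {E} {G} E⇒G x (y ∷ ps) =
    +-mono-≤ (elen-antitone E G (λ _ _ → E⇒G)) (wlen-coarsen E⇒G y ps)

  wend-through : ∀ x ps y qs → wend I x (ps ++ y ∷ qs) ≡ wend I y qs
  wend-through x [] y qs = refl
  wend-through x (p ∷ ps) y qs = wend-through p ps y qs

  wend-∷ʳ : ∀ x ps y → wend I x (ps ∷ʳ y) ≡ y
  wend-∷ʳ x ps y = wend-through x ps y []

  wend-∈ : ∀ x y ps → wend I x (y ∷ ps) ∈ y ∷ ps
  wend-∈ x y [] = here refl
  wend-∈ x y (z ∷ ps) = there (wend-∈ y z ps)

  wlen-nonneg : ∀ C x ps → 0ℚ ≤ wlen I C x ps
  wlen-nonneg C x [] = ≤-refl
  wlen-nonneg C x (y ∷ ps) = +-mono-≤ (elen-nonneg C x y) (wlen-nonneg C y ps)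

  wlen-∷ʳ : ∀ C x ps y → wlen I C x (ps ∷ʳ y) ≡ wlen I C x ps + elen I C (wend I x ps) y
  wlen-∷ʳ C x [] y = trans (+-identityʳ (elen I C x y)) (sym (+-identityˡ (elen I C x y)))
  wlen-∷ʳ C x (p ∷ ps) y = trans (cong (elen I C x p +_) (wlen-∷ʳ C p ps y))
                                 (sym (+-assoc (elen I C x p) (wlen I C p ps) _))

  wlen-prefix : ∀ C x ps y qs → wlen I C x (ps ∷ʳ y) ≤ wlen I C x (ps ++ y ∷ qs)
  wlen-prefix C x [] y qs = +-monoʳ-≤ (elen I C x y) (wlen-nonneg C y qs)
  wlen-prefix C x (p ∷ ps) y qs = +-monoʳ-≤ (elen I C x p) (wlen-prefix C p ps y qs)

  wlen-suffix : ∀ C x ps y qs → wlen I C y qs ≤ wlen I C x (ps ++ y ∷ qs)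
  wlen-suffix C x [] y qs = q≤p+q (elen-nonneg C x y)
  wlen-suffix C x (p ∷ ps) y qs = ≤-trans (wlen-suffix C p ps y qs) (q≤p+q (elen-nonneg C x p))

  walk-reverse : ∀ C x ps →
    ∃[ qs ] (wend I (wend I x ps) qs ≡ x × wlen I C (wend I x ps) qs ≡ wlen I C x ps)
  walk-reverse C x [] = [] , refl , refl
  walk-reverse C x (y ∷ ps) with walk-reverse C y ps
  ... | qs , back , same = qs ∷ʳ x , wend-∷ʳ z qs x , (begin
    wlen I C z (qs ∷ʳ x)                 ≡⟨ wlen-∷ʳ C z qs x ⟩
    wlen I C z qs + elen I C (wend I z qs) x ≡⟨ cong₂ _+_ same (cong (λ w → elen I C w x) back) ⟩
    wlen I C y ps + elen I C y x         ≡⟨ +-comm (wlen I C y ps) _ ⟩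
    elen I C y x + wlen I C y ps         ≡⟨ cong (_+ wlen I C y ps) (elen-sym C y x) ⟩
    elen I C x y + wlen I C y ps         ∎)
    where
    open ≡-Reasoning
    z : Fin n
    z = wend I y ps

  loop-erasure : ∀ C x ps → ∃[ qs ] (Unique (x ∷ qs) × wend I x qs ≡ wend I x ps ×
    wlen I C x qs ≤ wlen I C x ps × qs ⊆ ps)
  loop-erasure C x [] = [] , [] ∷ [] , refl , ≤-refl , λ ()
  loop-erasure C x (y ∷ ps) with loop-erasure C y ps
  ... | qs , uniq , end , shorter , qs⊆ps with x ∈? y ∷ qs
  ...   | no x∉ =
    y ∷ qs , ¬Any⇒All¬ _ x∉ ∷ uniq , end , +-monoʳ-≤ (elen I C x y) shorter , ∷⁺ʳ y qs⊆ps
  ...   | yes x∈ with ∈-∃++ x∈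
  ...     | pre , post , y∷qs≡ =
    post ,
    unique-suffix pre (subst Unique y∷qs≡ uniq) ,
    trans (sym (wend-through x pre x post)) (trans (cong (wend I x) (sym y∷qs≡)) end) ,
    ≤-trans (subst (λ ws → wlen I C x post ≤ wlen I C x ws) (sym y∷qs≡)
                   (wlen-suffix C x pre x post))
            (+-monoʳ-≤ (elen I C x y) shorter) ,
    ∷⁺ʳ y qs⊆ps ∘ subst (_ ∈_) (sym y∷qs≡) ∘ ∈-++⁺ʳ pre ∘ there

  mergeable-sym : ∀ {i C a b} → Mergeable I i C a b → Mergeable I i C b a
  mergeable-sym {i} {C} (aa , ab , a≢b , u , ps , u∈a , v∈b , short) =
    let (qs , back , same) = walk-reverse C u ps in
    ab , aa , a≢b ∘ sym , wend I u ps , qs , v∈b , subst (InSN I C _) (sym back) u∈a ,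
    subst (_≤ pow2 (suc i)) (sym same) short

  merge-cong : ∀ C a b {x y} → C x ≡ C y → merge I C a b x ≡ merge I C a b y
  merge-cong C a b = cong λ c → if does (c ≟ C b) then C a else c

  merge-≡ : ∀ C a b {x y} → merge I C a b x ≡ merge I C a b y →
    C x ≡ C y ⊎ (C x ≡ C a × C y ≡ C b) ⊎ (C x ≡ C b × C y ≡ C a)
  merge-≡ C a b {x} {y} e with C x ≟ C b | C y ≟ C b
  ... | yes x∈b | yes y∈b = inj₁ (trans x∈b (sym y∈b))
  ... | yes x∈b | no _ = inj₂ (inj₂ (x∈b , sym e))
  ... | no _ | yes y∈b = inj₂ (inj₁ (e , y∈b))
  ... | no _ | no _ = inj₁ e

  simple-path⇒adj : ∀ {i D x y u v} ms → Active I D i x → Active I D i y → D x ≢ D y →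
    InSN I D x u → InSN I D y v → Unique (u ∷ ms ∷ʳ v) → wlen I D u (ms ∷ʳ v) ≤ pow2 (suc i) →
    All (¬_ ∘ Active I D i) ms → Adj I i D x y
  simple-path⇒adj ms ax ay D≢ u∈x v∈y uniq short ¬ams =
    ax , ay , D≢ , _ , ms , _ , u∈x , v∈y , uniq , short ,
    λ w w∈ms (c , ac , (tw , w∈c) , _) → All.lookup ¬ams w∈ms (active-cong tw (sym w∈c) ac)

  -- A single stage

  module Stage (i : ℕ) (D : Clustering I) where

    Inactive : Fin n → Set
    Inactive w = ¬ Active I D i w

    connected⇒same⊎active : ∀ {x y} → IsTerm I y → Connected I i D x y →
      D x ≡ D y ⊎ (Active I D i x × Active I D i y)
    connected⇒same⊎active ty ε = inj₁ refl
    connected⇒same⊎active ty (inj₁ (ax , az , _) ◅ rest) =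
      inj₂ (ax , [ (λ z≡y → active-cong ty z≡y az) , proj₂ ]′ (connected⇒same⊎active ty rest))
    connected⇒same⊎active ty (inj₂ (tx , _ , x≡z) ◅ rest) =
      ⊎-map (trans x≡z) (map₁ (active-cong tx (sym x≡z))) (connected⇒same⊎active ty rest)

    record Invariant (C : Clustering I) : Set where
      field
        coarsens  : Coarsens D C
        connected : ∀ {x y} → IsTerm I x → IsTerm I y → C x ≡ C y → Connected I i D x y

    module _ {C : Clustering I} (inv : Invariant C) where
      open Invariant inv

      merged⇒same⊎active : ∀ {x y} → IsTerm I x → IsTerm I y → C x ≡ C y →
        D x ≡ D y ⊎ (Active I D i x × Active I D i y)
      merged⇒same⊎active tx ty C≡ = connected⇒same⊎active ty (connected tx ty C≡)

      active-refine : ∀ {x} → Active I C i x → Active I D i x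
      active-refine (tx , l , ((tl , l∈x) , _) , lvl) =
        [ (λ D≡ → member⇒active tx (tl , sym D≡) lvl) , proj₁ ]′
        (merged⇒same⊎active tx tl (sym l∈x))

      inactive-stableˡ : ∀ {y z} → Inactive y → CoarsensAt C D y z
      inactive-stableˡ ¬ay ty tz C≡ = [ id , ⊥-elim ∘ ¬ay ∘ proj₁ ]′ (merged⇒same⊎active ty tz C≡)

      inactive-stableʳ : ∀ {y z} → Inactive z → CoarsensAt C D y z
      inactive-stableʳ ¬az ty tz C≡ = [ id , ⊥-elim ∘ ¬az ∘ proj₂ ]′ (merged⇒same⊎active ty tz C≡)

      segment-stable : ∀ {x y} seg → C x ≢ C y → All Inactive seg →
        Linked (CoarsensAt C D) (x ∷ seg ∷ʳ y)
      segment-stable [] C≢ [] = (λ _ _ C≡ → contradiction C≡ C≢) ∷ [-]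
      segment-stable {y = y} (s ∷ seg) _ (¬as ∷ ¬aseg) =
        inactive-stableʳ ¬as ∷ from-inactive ¬as ¬aseg
        where
        from-inactive : ∀ {s seg} → Inactive s → All Inactive seg →
          Linked (CoarsensAt C D) (s ∷ seg ∷ʳ y)
        from-inactive ¬as [] = inactive-stableˡ ¬as ∷ [-]
        from-inactive ¬as (¬as′ ∷ ¬aseg) = inactive-stableˡ ¬as ∷ from-inactive ¬as′ ¬aseg

      erased-segment⇒adj : ∀ {x y seg qs} → InitLast qs → Active I D i x → Active I D i y →
        C x ≢ C y → All Inactive seg → Unique (x ∷ qs) → wend I x qs ≡ y →
        wlen I D x qs ≤ pow2 (suc i) → qs ⊆ seg ∷ʳ y → Adj I i D x y
      erased-segment⇒adj [] _ _ C≢ _ _ x≡y _ _ = contradiction (cong C x≡y) C≢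
      erased-segment⇒adj {x} {y} (ms ∷ʳ′ v) ax ay C≢ ¬aseg uniq@(_ ∷ uniq-ms) end short qs⊆ =
        simple-path⇒adj ms ax ay (C≢ ∘ coarsens) (proj₁ ax , refl) v∈y uniq short
          (anti-mono (⊆-∷ʳ⁻ y∉ms (qs⊆ ∘ ∈-++⁺ˡ)) ¬aseg)
        where
        v≡y : v ≡ y
        v≡y = trans (sym (wend-∷ʳ x ms v)) end
        v∈y : InSN I D y v
        v∈y = subst (IsTerm I) (sym v≡y) (proj₁ ay) , cong D v≡y
        y∉ms : y ∉ ms
        y∉ms = subst (_∉ ms) v≡y (∷ʳ-unique⇒∉ ms uniq-ms)

      segment-connected : ∀ {x y} seg → Active I D i x → Active I D i y → All Inactive seg →
        wlen I C x (seg ∷ʳ y) ≤ pow2 (suc i) → Connected I i D x y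
      segment-connected {x} {y} seg ax ay ¬aseg short =
        [ connected (proj₁ ax) (proj₁ ay) , separated ]′ (toSum (C x ≟ C y))
        where
        separated : C x ≢ C y → Connected I i D x y
        separated C≢ =
          let (qs , uniq , end , shorter , qs⊆) = loop-erasure D x (seg ∷ʳ y)
              D-short = wlen-antitone (seg ∷ʳ y) (segment-stable seg C≢ ¬aseg)
              end-y = trans end (wend-∷ʳ x seg y)
          in inj₁ (erased-segment⇒adj (initLast qs) ax ay C≢ ¬aseg uniq end-y
                     (≤-trans shorter (≤-trans D-short short)) qs⊆) ◅ ε

      ShortWalkConnects : Fin n → List (Fin n) → Set
      ShortWalkConnects x ws = wlen I C x ws ≤ pow2 (suc i) → Active I D i (wend I x ws) →
        Connected I i D x (wend I x ws)

      -- seg is the part of the walk traversed since its last active vertex x.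
      walk-connected : ∀ {x} seg ps → Active I D i x → All Inactive seg →
        ShortWalkConnects x (seg ++ ps)
      walk-connected [] [] _ _ _ _ = ε
      walk-connected {x} (s ∷ seg) [] _ ¬aseg _ az =
        contradiction az (All.lookup (++⁺ ¬aseg []) (wend-∈ x s (seg ++ [])))
      walk-connected {x} seg (y ∷ ps) ax ¬aseg = [ cut , extend ]′ (toSum (active? D i y))
        where
        extend : Inactive y → ShortWalkConnects x (seg ++ y ∷ ps)
        extend ¬ay = subst (ShortWalkConnects x) (∷ʳ-++ seg y ps)
                           (walk-connected (seg ∷ʳ y) ps ax (∷ʳ⁺ ¬aseg ¬ay))
        cut : Active I D i y → ShortWalkConnects x (seg ++ y ∷ ps)
        cut ay short az = subst (Connected I i D x) (sym (wend-through x seg y ps))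
          (segment-connected seg ax ay ¬aseg (≤-trans (wlen-prefix C x seg y ps) short) ◅◅
           walk-connected [] ps ay [] (≤-trans (wlen-suffix C x seg y ps) short)
             (subst (Active I D i) (wend-through x seg y ps) az))

      mergeable⇒connected : ∀ {a b} → Mergeable I i C a b → Connected I i D a b
      mergeable⇒connected (aa , ab , _ , u , ps , (tu , u∈a) , (tv , v∈b) , short) =
        connected (proj₁ aa) tu (sym u∈a) ◅◅
        walk-connected [] ps (active-refine (active-cong tu (sym u∈a) aa)) [] short
          (active-refine (active-cong tv (sym v∈b) ab)) ◅◅
        connected tv (proj₁ ab) v∈b

      invariant-merge : ∀ {a b} → Mergeable I i C a b → Invariant (merge I C a b)
      invariant-merge {a} {b} m@(aa , ab , _) = record
        { coarsens = merge-cong C a b ∘ coarsens ; connected = joined }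
        where
        joined : ∀ {x y} → IsTerm I x → IsTerm I y → merge I C a b x ≡ merge I C a b y →
          Connected I i D x y
        joined {x} {y} tx ty e = [ connected tx ty , [ via-ab , via-ba ]′ ]′ (merge-≡ C a b e)
          where
          via-ab : C x ≡ C a × C y ≡ C b → Connected I i D x y
          via-ab (x∈a , y∈b) =
            connected tx (proj₁ aa) x∈a ◅◅ mergeable⇒connected m ◅◅
            connected (proj₁ ab) ty (sym y∈b)
          via-ba : C x ≡ C b × C y ≡ C a → Connected I i D x y
          via-ba (x∈b , y∈a) =
            connected tx (proj₁ ab) x∈b ◅◅ mergeable⇒connected (mergeable-sym m) ◅◅
            connected (proj₁ aa) ty (sym y∈a)

    invariant-star : ∀ {C C′} → Star (StageStep I i) C C′ → Invariant C → Invariant C′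
    invariant-star ε inv = inv
    invariant-star (step _ _ _ m ◅ steps) inv = invariant-star steps (invariant-merge inv m)

    invariant-start : Invariant D
    invariant-start = record { coarsens = id ; connected = λ tx ty D≡ → inj₂ (tx , ty , D≡) ◅ ε }

    invariant-run : ∀ {C′} → StageRun I i D C′ → Invariant C′
    invariant-run run = invariant-star (proj₁ run) invariant-start

    module _ {C′ : Clustering I} (run : StageRun I i D C′) where
      open Invariant (invariant-run run)

      adj⇒merged : ∀ {x y} → Adj I i D x y → C′ x ≡ C′ y
      adj⇒merged {x} {y} (ax , ay , _ , u , ms , v , (tu , u∈x) , (tv , v∈y) , _ , short , _) =
        decidable-stable (C′ x ≟ C′ y) (λ C′≢ → proj₂ run (x , y , mergeable C′≢))
        where
        mergeable : C′ x ≢ C′ y → Mergeable I i C′ x y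
        mergeable C′≢ =
          active-coarsen coarsens ax , active-coarsen coarsens ay , C′≢ , u , ms ∷ʳ v ,
          (tu , coarsens u∈x) , subst (InSN I C′ y) (sym (wend-∷ʳ u ms v)) (tv , coarsens v∈y) ,
          ≤-trans (wlen-coarsen coarsens u (ms ∷ʳ v)) short

      connected⇒merged : ∀ {x y} → Connected I i D x y → C′ x ≡ C′ y
      connected⇒merged ε = refl
      connected⇒merged (inj₁ xz ◅ rest) = trans (adj⇒merged xz) (connected⇒merged rest)
      connected⇒merged (inj₂ (_ , _ , D≡) ◅ rest) = trans (coarsens D≡) (connected⇒merged rest)

lemma5p4 : ∀ {n} (I : Instance n) (R : Run I) (i : ℕ) →
    ∃[ s ] (IsTerm I s × LevelGe I s i) →
    ∀ a b → IsTerm I a → IsTerm I b →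
    ((Run.Cs R (suc i) a ≡ Run.Cs R (suc i) b → Connected I i (Run.Cs R i) a b)
     × (Connected I i (Run.Cs R i) a b → Run.Cs R (suc i) a ≡ Run.Cs R (suc i) b))
-- The argument works for every stage.
lemma5p4 I R i _ a b ta tb = Invariant.connected (invariant-run run) ta tb , connected⇒merged run
  where
  open Stage I i (Run.Cs R i)
  run : StageRun I i (Run.Cs R i) (Run.Cs R (suc i))
  run = Run.stages R i
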